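{- Let $D$ be a finite simple digraph with at least one vertex (no loops, no parallel arcs; opposite arcs allowed) whose arcs are each colored either blue or red; write $u \to v$ if $(u,v)$ is an arc, and $u \overset{b}{\to} v$ (resp. $u \overset{r}{\to} v$) if it is a blue (resp. red) arc. Suppose that for all vertices $u,v,w$: (i) if $u \overset{b}{\to} v$ and $v \overset{b}{\to} w$, then $u \overset{b}{\to} w$, or ($w \overset{r}{\to} u$ and $w \overset{r}{\to} v$); (ii) if $u \overset{r}{\to} v$ and $v \overset{r}{\to} w$, then $u \overset{r}{\to} w$, or ($v \overset{b}{\to} u$ and $w \overset{b}{\to} u$). Then there is a vertex $v$ such that for every vertex $w$, $v \overset{r}{\to} w$ implies $w \to v$. -}

module Defs where

open import Data.Nat using (ℕ)
open import Data.Fin using (Fin)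
open import Data.Maybe using (Maybe; just; nothing; Is-just)
open import Data.Sum using (_⊎_)
open import Data.Product using (_×_)
open import Relation.Binary.PropositionalEquality using (_≡_)

data Colour : Set where
  blue red : Colour

-- A finite simple digraph on vertex set Fin n whose arcs are coloured blue/red.
-- arc u v = nothing : no arc (u,v); arc u v = just c : arc (u,v) of colour c.
-- At most one arc per ordered pair (no parallel arcs); opposite arcs allowed.
record ColouredDigraph (n : ℕ) : Set where
  field
    arc    : Fin n → Fin n → Maybe Colour
    noLoop : ∀ u → arc u u ≡ nothing

module _ {n : ℕ} (D : ColouredDigraph n) where
  open ColouredDigraph D

  _⟶_ : Fin n → Fin n → Set
  u ⟶ v = Is-just (arc u v)

  _⟶b_ : Fin n → Fin n → Set
  u ⟶b v = arc u v ≡ just blue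

  _⟶r_ : Fin n → Fin n → Set
  u ⟶r v = arc u v ≡ just red

  CondI : Set
  CondI = ∀ u v w → u ⟶b v → v ⟶b w → (u ⟶b w) ⊎ ((w ⟶r u) × (w ⟶r v))

  CondII : Set
  CondII = ∀ u v w → u ⟶r v → v ⟶r w → (u ⟶r w) ⊎ ((v ⟶b u) × (w ⟶b u))

-- Take a vertex v whose red out-neighbourhood R(v) is smallest. If v →r w but
-- w ↛ v, then condition (ii) gives R(w) ⊆ R(v): for w →r x, the alternative
-- "w →b v" is excluded. Moreover w ∈ R(v) ∖ R(w) as there are no loops, so
-- R(w) ⊂ R(v), contradicting the minimality of v.
module Submission where

open import Defs
open import Level using (Level)
open import Data.Nat using (ℕ; suc; _≤_)
open import Data.Nat.Properties using (<⇒≱)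
open import Data.Fin using (Fin; zero)
open import Data.Fin.Subset using (Subset; _∈_; _⊂_; ∣_∣)
open import Data.Fin.Subset.Properties using (p⊂q⇒∣p∣<∣q∣)
open import Data.Bool using (true)
open import Data.Vec using (tabulate)
open import Data.Vec.Properties using (lookup∘tabulate; lookup⇒[]=; []=⇒lookup)
open import Data.List using (allFin)
open import Data.List.Relation.Unary.All as All using ()
open import Data.List.Membership.Propositional.Properties using (∈-allFin)
open import Data.List.Extrema.Nat using (argmin; f[argmin]≤f[xs])
open import Data.Maybe using (just; nothing; Is-just)
open import Data.Maybe.Relation.Unary.Any using (just)
open import Data.Maybe.Properties using (≡-dec)
open import Data.Unit using (tt)
open import Data.Product using (∃-syntax; _,_)
open import Data.Sum using (inj₁; inj₂)
open import Data.Empty using (⊥-elim)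
open import Relation.Nullary using (Dec; yes; no; does; ¬_)
open import Relation.Nullary.Decidable using (dec-true)
open import Relation.Unary using (Pred; Decidable)
open import Relation.Binary.Definitions using (DecidableEquality)
open import Relation.Binary.PropositionalEquality using (_≡_; refl; trans; sym)

private
  variable
    ℓ : Level
    n : ℕ

∃-minimiser : (f : Fin (suc n) → ℕ) → ∃[ v ] (∀ w → f v ≤ f w)
∃-minimiser {n} f = argmin f zero (allFin (suc n)) ,
  λ w → All.lookup (f[argmin]≤f[xs] {f = f} zero (allFin (suc n))) (∈-allFin w)

subset : {P : Pred (Fin n) ℓ} → Decidable P → Subset n
subset P? = tabulate (λ x → does (P? x))

module _ {P : Pred (Fin n) ℓ} (P? : Decidable P) where

  ∈-subset⁺ : ∀ {x} → P x → x ∈ subset P?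
  ∈-subset⁺ {x} px = lookup⇒[]= x (subset P?)
    (trans (lookup∘tabulate _ x) (dec-true (P? x) px))

  ∈-subset⁻ : ∀ {x} → x ∈ subset P? → P x
  ∈-subset⁻ {x} x∈ = does-true (P? x)
    (trans (sym (lookup∘tabulate _ x)) ([]=⇒lookup x∈))
    where
    does-true : ∀ {A : Set ℓ} (a? : Dec A) → does a? ≡ true → A
    does-true (yes a) _ = a
    does-true (no _)  ()

_≟ᶜ_ : DecidableEquality Colour
blue ≟ᶜ blue = yes refl
blue ≟ᶜ red  = no λ ()
red  ≟ᶜ blue = no λ ()
red  ≟ᶜ red  = yes refl

module _ {n : ℕ} (D : ColouredDigraph n) where
  open ColouredDigraph D

  _⟶r?_ : ∀ u v → Dec (_⟶r_ D u v)
  u ⟶r? v = ≡-dec _≟ᶜ_ (arc u v) (just red)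

  redOut : Fin n → Subset n
  redOut u = subset (u ⟶r?_)

  redOut-⊂ : CondII D → ∀ {v w} → _⟶r_ D v w → arc w v ≡ nothing →
    redOut w ⊂ redOut v
  redOut-⊂ condII {v} {w} v⟶rw w↛v =
    redOut-⊆ , w , ∈-subset⁺ (v ⟶r?_) v⟶rw , λ w∈ → w↛w (∈-subset⁻ (w ⟶r?_) w∈)
    where
    w↛w : ¬ (_⟶r_ D w w)
    w↛w w⟶rw with trans (sym (noLoop w)) w⟶rw
    ... | ()
    redOut-⊆ : ∀ {x} → x ∈ redOut w → x ∈ redOut v
    redOut-⊆ {x} x∈ with condII v w x v⟶rw (∈-subset⁻ (w ⟶r?_) x∈)
    ... | inj₁ v⟶rx = ∈-subset⁺ (v ⟶r?_) v⟶rx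
    ... | inj₂ (w⟶bv , _) with trans (sym w↛v) w⟶bv
    ...   | ()

  redOut-minimal⇒arc-back : CondII D → ∀ {v} → (∀ u → ∣ redOut v ∣ ≤ ∣ redOut u ∣) →
    ∀ w → _⟶r_ D v w → _⟶_ D w v
  redOut-minimal⇒arc-back condII {v} minimal w v⟶rw = is-just (arc w v) refl
    where
    is-just : ∀ a → arc w v ≡ a → Is-just a
    is-just (just _) _ = just tt
    is-just nothing w↛v =
      ⊥-elim (<⇒≱ (p⊂q⇒∣p∣<∣q∣ (redOut-⊂ condII v⟶rw w↛v)) (minimal w))

lemma2p3 : (n : ℕ) (D : ColouredDigraph (suc n)) → CondI D → CondII D →
    ∃[ v ] (∀ w → _⟶r_ D v w → _⟶_ D w v)
lemma2p3 n D _ condII =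
  let v , minimal = ∃-minimiser (λ u → ∣ redOut D u ∣) in
  v , redOut-minimal⇒arc-back D condII minimal
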